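{- Let $\mathcal{G}=(V,E)$ be a temporal graph, $R=(v_i)_{i=1}^k$ a route, and $j,y,\delta\in\mathbb{N}$ with $1\le j\le k$. Let $R_j=(v_i)_{i=1}^j$, and define the table $A_{R_1}[y']=0$ for all $y'$ and, for $2\le i\le k$, $A_{R_i}[y']=\max_{0\le y''\le y'}\, a(v_{i-1},v_i,A_{R_{i-1}}[y''],y'-y'')$. Then $A_{R_j}[y]$ is the worst-case arrival time of $R_j$ for up to $y$ delays. In particular, $R_j$ is $y$-delay-robust if and only if $A_{R_j}[y]<\infty$.
   Context: A temporal graph $\mathcal{G}=(V,E)$ consists of a finite vertex set $V$ and a finite set $E$ of time arcs $e=(v,w,t,\lambda)$ with start vertex $v$, end vertex $w$, time label $t(e)=t\in\mathbb{N}$ and traversal time $\lambda(e)=\lambda\in\mathbb{N}$. A temporal walk is a sequence of time arcs $(v_i,w_i,t_i,\lambda_i)_{i=1}^{\ell}$ with $v_{i+1}=w_i$ and $t_{i+1}\ge t_i+\lambda_i$ for all $i<\ell$. Delays are traversal delays of a fixed $\delta$: for $D\subseteq E$ a $D$-delayed temporal walk is a temporal walk in the graph where the traversal time of every arc in $D$ is increased by $\delta$. A route is a sequence of vertices; a delayed temporal walk follows a route if the vertices it visits are exactly those of the route, in order; a temporal path is a walk visiting no vertex twice. A route $R$ is $y$-delay-robust if for all $D\subseteq E$ with $|D|\le y$ some $D$-delayed temporal walk follows $R$. For a delay set $D$, the earliest delayed arrival time of a route $(v_i)_{i=1}^k$ is the minimum of $t(e_{k-1})+\lambda(e_{k-1})+[e_{k-1}\in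 D]\delta$ over all $D$-delayed temporal paths $(e_1,\dots,e_{k-1})$ following it (and the single-vertex route has arrival time $0$). The worst-case arrival time of a route for $y$ delays is the maximum of its earliest delayed arrival time over all $D\subseteq E$ with $|D|\le y$, and is $\infty$ if the route is not $y$-delay-robust. For vertices $v,w$, a time $t$ and $y\in\mathbb{N}$, let $E(v,w,t)=\{(v,w,t',\lambda)\in E: t'\ge t\}=\{a_1,\dots,a_\ell\}$ ordered so that $t(a_i)+\lambda(a_i)\le t(a_{i+1})+\lambda(a_{i+1})$, and define $a(v,w,t,y)=\min\{t(a_1)+\lambda(a_1)+\delta,\ t(a_{y+1})+\lambda(a_{y+1})\}$, where a term involving a nonexistent arc is $\infty$ (and $a(v,w,\infty,y)=\infty$). -}

module Defs where

open import Data.Nat using (ℕ; zero; suc; _+_; _∸_; _≤_; _≤ᵇ_)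
open import Data.Nat.Properties using (≤-decTotalOrder)
import Data.Nat as ℕ
open import Data.Bool using (Bool; true; false; if_then_else_; _∧_)
open import Data.Fin using (Fin)
open import Data.Fin.Subset using (Subset; ∣_∣; _∈_)
open import Data.List using (List; []; _∷_; map; filter; length; last)
open import Data.List.Relation.Unary.Unique.Propositional using (Unique)
open import Data.Maybe using (Maybe; just; nothing)
open import Data.Vec using (lookup)
open import Data.Product using (Σ; _×_; _,_; ∃; ∃-syntax)
open import Data.Sum using (_⊎_)
open import Relation.Binary.PropositionalEquality using (_≡_)
open import Relation.Nullary using (¬_; does)
open import Data.List.Sort ≤-decTotalOrder using (sort)
import Data.Fin.Properties as FinP

data ℕ∞ : Set where
  fin : ℕ → ℕ∞
  ∞   : ℕ∞

_⊔∞_ : ℕ∞ → ℕ∞ → ℕ∞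
fin a ⊔∞ fin b = fin (a ℕ.⊔ b)
_     ⊔∞ _     = ∞

_⊓∞_ : ℕ∞ → ℕ∞ → ℕ∞
fin a ⊓∞ fin b = fin (a ℕ.⊓ b)
fin a ⊓∞ ∞     = fin a
∞     ⊓∞ x     = x

data _≤∞_ : ℕ∞ → ℕ∞ → Set where
  fin≤fin : ∀ {a b} → a ≤ b → fin a ≤∞ fin b
  _≤∞∞    : ∀ x → x ≤∞ ∞

IsFinite : ℕ∞ → Set
IsFinite x = ∃[ n ] (x ≡ fin n)

-- Temporal graphs: vertex set Fin n, arc set E = {E i | i : Fin m}
-- (E is required to be injective, so that E is a set of m arcs).

record Arc (n : ℕ) : Set where
  constructor arc
  field
    start : Fin n
    end   : Fin n
    time  : ℕ
    trav  : ℕ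
open Arc public

record TemporalGraph (n m : ℕ) : Set where
  field
    arcs : Fin m → Arc n
open TemporalGraph public

Route : ℕ → Set
Route n = List (Fin n)

module _ {n m : ℕ} (G : TemporalGraph n m) (δ : ℕ) where

  delayOf : Subset m → Fin m → ℕ
  delayOf D i = if lookup D i then δ else 0

  delayedArr : Subset m → Fin m → ℕ
  delayedArr D i = time (arcs G i) + trav (arcs G i) + delayOf D i

  data DelayedWalk (D : Subset m) : List (Fin m) → Set where
    []  : DelayedWalk D []
    [_] : ∀ i → DelayedWalk D (i ∷ [])
    _∷_ : ∀ {i j es} →
          (end (arcs G i) ≡ start (arcs G j)) × (delayedArr D i ≤ time (arcs G j)) →
          DelayedWalk D (j ∷ es) → DelayedWalk D (i ∷ j ∷ es)

  visits : List (Fin m) → List (Fin n)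
  visits []       = []
  visits (i ∷ es) = start (arcs G i) ∷ map (λ j → end (arcs G j)) (i ∷ es)

  -- a walk follows a route if it visits exactly the vertices of the
  -- route, in order (convention: the empty walk follows every
  -- single-vertex route)
  data Follows : List (Fin m) → Route n → Set where
    single : ∀ v → Follows [] (v ∷ [])
    step   : ∀ {i es v w R} →
             start (arcs G i) ≡ v → end (arcs G i) ≡ w →
             Follows es (w ∷ R) → Follows (i ∷ es) (v ∷ w ∷ R)

  IsPath : List (Fin m) → Set
  IsPath es = Unique (visits es)

  -- arrival time of a nonempty delayed walk (the empty walk: 0)
  walkArr : Subset m → List (Fin m) → ℕ
  walkArr D es with last es
  ... | just i  = delayedArr D i
  ... | nothing = 0

  DelayedPathFollowing : Subset m → Route n → List (Fin m) → Set
  DelayedPathFollowing D R es = DelayedWalk D es × IsPath es × Follows es R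

  Robust : ℕ → Route n → Set
  Robust y R = ∀ (D : Subset m) → ∣ D ∣ ≤ y →
               ∃[ es ] (DelayedWalk D es × Follows es R)

  EarliestArrival : Subset m → Route n → ℕ∞ → Set
  EarliestArrival D []            x = x ≡ ∞   -- empty route: no walk follows it
  EarliestArrival D (v ∷ [])      x = x ≡ fin 0
  EarliestArrival D R@(_ ∷ _ ∷ _) x =
      (x ≡ ∞ × (∀ es → ¬ DelayedPathFollowing D R es))
    ⊎ (∃[ t ] (x ≡ fin t
        × (∃[ es ] (DelayedPathFollowing D R es × walkArr D es ≡ t))
        × (∀ es → DelayedPathFollowing D R es → t ≤ walkArr D es)))

  WorstCaseArrival : ℕ → Route n → ℕ∞ → Set
  WorstCaseArrival y R x =
      (¬ Robust y R × x ≡ ∞)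
    ⊎ (Robust y R
        × (∀ (D : Subset m) → ∣ D ∣ ≤ y → ∀ z → EarliestArrival D R z → z ≤∞ x)
        × (∃[ D ] (∣ D ∣ ≤ y × EarliestArrival D R x)))

  arrTimes : Fin n → Fin n → ℕ → List ℕ
  arrTimes v w t =
    sort (map (λ e → time e + trav e)
           (filter (λ e → start e FinP.≟ v) 
             (filter (λ e → end e FinP.≟ w)
               (filter (λ e → t ℕ.≤? time e)
                 (Data.List.map (arcs G) (Data.List.allFin m))))))
    where import Data.List

  nth∞ : List ℕ → ℕ → ℕ∞
  nth∞ []       _       = ∞
  nth∞ (x ∷ xs) zero    = fin x
  nth∞ (x ∷ xs) (suc k) = nth∞ xs k

  plusδ : ℕ∞ → ℕ∞
  plusδ (fin x) = fin (x + δ)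
  plusδ ∞       = ∞

  aFun : Fin n → Fin n → ℕ∞ → ℕ → ℕ∞
  aFun v w ∞       y = ∞
  aFun v w (fin t) y = plusδ (nth∞ (arrTimes v w t) 0) ⊓∞ nth∞ (arrTimes v w t) y

  maxUpTo : ℕ → (ℕ → ℕ∞) → ℕ∞
  maxUpTo zero    f = f 0
  maxUpTo (suc k) f = maxUpTo k f ⊔∞ f (suc k)

  -- given the table T of the prefix ending in u, extend by the rest
  tableFrom : (ℕ → ℕ∞) → Fin n → Route n → (ℕ → ℕ∞)
  tableFrom T u []       = T
  tableFrom T u (w ∷ ws) =
    tableFrom (λ y' → maxUpTo y' (λ y'' → aFun u w (T y'') (y' ∸ y''))) w ws

  -- A_R; A_{(v)}[y'] = 0.  (The empty route is never used; junk value.)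
  table : Route n → ℕ → ℕ∞
  table []       = λ _ → ∞
  table (v ∷ vs) = tableFrom (λ _ → fin 0) v vs

-- For a fixed delay set D the earliest arrival along a route is computed greedily: from
-- the earliest arrival τ at u, the earliest arrival at the next vertex w is the least
-- delayed arrival time of the arcs u → w departing at or after τ.  If at most k of those
-- arcs are delayed, this is at most the first arrival plus δ, and also at most the
-- (k+1)-st arrival, since one of the k+1 earliest arcs is undelayed; so it is at most
-- a(u,w,τ,k).  Delaying exactly the arcs that arrive before the (k+1)-st arrival attains
-- this bound, which makes a monotone in τ and in k.  Since the route visits each vertex
-- once, delays on arcs into w influence only the hop into w, so a delay set with at most
-- y arcs splits into y″ delays before w and at most y − y″ on the last hop; this is the
-- recurrence defining A.  Robustness for D is finiteness of the greedy arrival time,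
-- which is then the earliest arrival over temporal paths.
module Submission where

open import Data.Bool using (Bool; true; false; T; T?; if_then_else_; _∧_; _∨_)
open import Data.Bool.Properties using (∧-zeroʳ; ∧-identityʳ; ∨-identityʳ)
open import Data.Empty using (⊥-elim)
open import Data.Fin using (Fin; zero; suc)
open import Data.Fin.Properties using (_≟_)
open import Data.Fin.Subset using (Subset; ⊥; ∣_∣; _∪_; _∩_; _─_)
open import Data.Fin.Subset.Properties using (∣p∣≤∣x∷p∣; ∣⊥∣≡0; ∣p∩q∣≤∣p∣; ∣p─q∣≤∣p∣)
open import Data.List using (List; []; _∷_; _∷ʳ_; map; filter; length; allFin; tabulate; take)
open import Data.List.Properties using (map-∘)
open import Data.List.Membership.Propositional using (_∈_; _∉_)
open import Data.List.Membership.Propositional.Properties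
  using (∈-map⁻; ∈-map⁺; ∈-filter⁻; ∈-filter⁺; ∈-allFin)
open import Data.List.Relation.Binary.Permutation.Propositional
  using (_↭_; prep; swap; ↭-sym) renaming (refl to ↭-refl; trans to ↭-trans)
open import Data.List.Relation.Binary.Permutation.Propositional.Properties using (∈-resp-↭)
import Data.List.Relation.Unary.All as All
import Data.List.Relation.Unary.All.Properties as All
open import Data.List.Relation.Unary.AllPairs using ([]; _∷_)
open import Data.List.Relation.Unary.Any using (here; there)
open import Data.List.Relation.Unary.Linked using (_∷_) renaming (tail to Sorted-tail)
open import Data.List.Relation.Unary.Unique.Propositional using (Unique)
open import Data.List.Relation.Unary.Unique.Propositional.Properties using (take⁺)
open import Data.List.Reverse using (Reverse; reverseView; []; _∶_∶ʳ_)
open import Data.Nat using (ℕ; zero; suc; _+_; _∸_; _≤_; _<_; _≤ᵇ_; _<ᵇ_; _≤?_; z≤n; s≤s; s≤s⁻¹)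
open import Data.Nat.Properties
  using ( ≤-refl; ≤-reflexive; ≤-trans; ≤-antisym; ≤-<-trans; <-≤-trans; <-trans; <⇒≱; ≮⇒≥; n<1+n
        ; m≤n⇒m≤1+n; m≤n⇒m<n∨m≡n; ≤-totalOrder; ≤-decTotalOrder; ≤ᵇ⇒≤; ≤⇒≤ᵇ; <ᵇ⇒<; <⇒<ᵇ
        ; +-identityʳ; +-suc; +-mono-≤; +-monoˡ-≤; +-monoʳ-≤; m≤m+n; m+n∸m≡n; m+[n∸m]≡n; ∸-monoˡ-≤
        ; ⊔-sel; m≤m⊔n; m≤n⊔m; ⊓-sel; m⊓n≤m; m⊓n≤n; ⊓-glb; module ≤-Reasoning )
open import Data.List.Relation.Unary.Sorted.TotalOrder ≤-totalOrder using (Sorted)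
open import Data.List.Sort ≤-decTotalOrder using (sort; sort-↭; sort-↗)
import Data.Product as Product
open import Data.Product using (_×_; _,_; proj₁; proj₂; ∃-syntax; map₁; map₂)
import Data.Sum as Sum
open import Data.Sum using (_⊎_; inj₁; inj₂)
import Data.Vec as Vec
open import Data.Vec using (lookup)
open import Data.Vec.Properties using (lookup-zipWith; lookup-replicate; lookup∘tabulate; tabulate∘lookup)
open import Function using (_∘_)
open import Function.Bundles using (_⇔_; mk⇔; Equivalence)
open import Function.Definitions using (Injective)
open import Relation.Binary.Bundles using (Poset)
open import Relation.Binary.Structures using (IsPartialOrder)
import Relation.Binary.Reasoning.PartialOrder as PosetReasoning
open import Relation.Binary.PropositionalEquality
  using (_≡_; _≢_; refl; sym; trans; cong; cong₂; subst; subst₂; module ≡-Reasoning)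
import Relation.Binary.PropositionalEquality.Properties as ≡
open import Relation.Nullary using (¬_; does; yes; no)
open import Relation.Nullary.Decidable using (dec-true; dec-false)
open import Relation.Unary using (Decidable)

open import Defs

≤∞-refl : ∀ {x} → x ≤∞ x
≤∞-refl {fin x} = fin≤fin ≤-refl
≤∞-refl {∞}     = ∞ ≤∞∞

≤∞-trans : ∀ {x y z} → x ≤∞ y → y ≤∞ z → x ≤∞ z
≤∞-trans (fin≤fin p) (fin≤fin q) = fin≤fin (≤-trans p q)
≤∞-trans _           (_ ≤∞∞)     = _ ≤∞∞

≤∞-antisym : ∀ {x y} → x ≤∞ y → y ≤∞ x → x ≡ y
≤∞-antisym (fin≤fin p) (fin≤fin q) = cong fin (≤-antisym p q)
≤∞-antisym (∞ ≤∞∞)     (∞ ≤∞∞)     = refl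

≤∞-isPartialOrder : IsPartialOrder _≡_ _≤∞_
≤∞-isPartialOrder = record
  { isPreorder = record
    { isEquivalence = ≡.isEquivalence
    ; reflexive     = λ { refl → ≤∞-refl }
    ; trans         = ≤∞-trans
    }
  ; antisym = ≤∞-antisym
  }

≤∞-poset : Poset _ _ _
≤∞-poset = record { isPartialOrder = ≤∞-isPartialOrder }

module ≤∞-Reasoning = PosetReasoning ≤∞-poset

fin≤fin⁻ : ∀ {a b} → fin a ≤∞ fin b → a ≤ b
fin≤fin⁻ (fin≤fin a≤b) = a≤b

∞≰fin : ∀ {b} → ¬ ∞ ≤∞ fin b
∞≰fin ()

≤∞fin⇒finite : ∀ {x t} → x ≤∞ fin t → IsFinite x
≤∞fin⇒finite (fin≤fin {a} _) = a , refl

x≤∞x⊔∞y : ∀ x y → x ≤∞ (x ⊔∞ y)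
x≤∞x⊔∞y (fin x) (fin y) = fin≤fin (m≤m⊔n x y)
x≤∞x⊔∞y (fin x) ∞       = _ ≤∞∞
x≤∞x⊔∞y ∞       y       = _ ≤∞∞

y≤∞x⊔∞y : ∀ x y → y ≤∞ (x ⊔∞ y)
y≤∞x⊔∞y (fin x) (fin y) = fin≤fin (m≤n⊔m x y)
y≤∞x⊔∞y (fin x) ∞       = _ ≤∞∞
y≤∞x⊔∞y ∞       y       = _ ≤∞∞

⊔∞-sel : ∀ x y → (x ⊔∞ y ≡ x) ⊎ (x ⊔∞ y ≡ y)
⊔∞-sel (fin x) (fin y) = Sum.map (cong fin) (cong fin) (⊔-sel x y)
⊔∞-sel (fin x) ∞       = inj₂ refl
⊔∞-sel ∞       y       = inj₁ refl

x⊓∞y≤∞x : ∀ x y → (x ⊓∞ y) ≤∞ x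
x⊓∞y≤∞x (fin x) (fin y) = fin≤fin (m⊓n≤m x y)
x⊓∞y≤∞x (fin x) ∞       = ≤∞-refl
x⊓∞y≤∞x ∞       y       = _ ≤∞∞

x⊓∞y≤∞y : ∀ x y → (x ⊓∞ y) ≤∞ y
x⊓∞y≤∞y (fin x) (fin y) = fin≤fin (m⊓n≤n x y)
x⊓∞y≤∞y (fin x) ∞       = _ ≤∞∞
x⊓∞y≤∞y ∞       y       = ≤∞-refl

⊓∞-glb : ∀ {x y z} → z ≤∞ x → z ≤∞ y → z ≤∞ (x ⊓∞ y)
⊓∞-glb (fin≤fin p) (fin≤fin q) = fin≤fin (⊓-glb p q)
⊓∞-glb (fin≤fin p) (_ ≤∞∞)     = fin≤fin p
⊓∞-glb (_ ≤∞∞)     q           = q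

_<ᵇ∞_ : ℕ → ℕ∞ → Bool
x <ᵇ∞ fin z = x <ᵇ z
x <ᵇ∞ ∞     = true

≮ᵇ∞⇒≥ : ∀ {x} τ → ¬ T (x <ᵇ∞ τ) → τ ≤∞ fin x
≮ᵇ∞⇒≥ (fin z) x≮z = fin≤fin (≮⇒≥ (x≮z ∘ <⇒<ᵇ))
≮ᵇ∞⇒≥ ∞       x≮∞ = ⊥-elim (x≮∞ _)

module _ {A : Set} (f : A → ℕ) where

  minOver : List A → ℕ∞
  minOver []       = ∞
  minOver (x ∷ xs) = fin (f x) ⊓∞ minOver xs

  minOver-lb : ∀ {xs i} → i ∈ xs → minOver xs ≤∞ fin (f i)
  minOver-lb {x ∷ xs} (here refl) = x⊓∞y≤∞x (fin (f x)) (minOver xs)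
  minOver-lb {x ∷ xs} (there i∈)  = ≤∞-trans (x⊓∞y≤∞y (fin (f x)) (minOver xs)) (minOver-lb i∈)

  minOver-glb : ∀ {z} xs → (∀ {i} → i ∈ xs → z ≤∞ fin (f i)) → z ≤∞ minOver xs
  minOver-glb []       _ = _ ≤∞∞
  minOver-glb (x ∷ xs) h = ⊓∞-glb (h (here refl)) (minOver-glb xs (h ∘ there))

  minOver-⊇ : ∀ {xs} ys → (∀ {i} → i ∈ ys → i ∈ xs) → minOver xs ≤∞ minOver ys
  minOver-⊇ ys ys⊆xs = minOver-glb ys (minOver-lb ∘ ys⊆xs)

  minOver-attained : ∀ xs {t} → minOver xs ≡ fin t → ∃[ i ] (i ∈ xs × f i ≡ t)
  minOver-attained (x ∷ xs) eq with minOver xs in eqᵣ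
  minOver-attained (x ∷ xs) refl | ∞     = x , here refl , refl
  minOver-attained (x ∷ xs) refl | fin t with ⊓-sel (f x) t
  ... | inj₁ fx⊓t≡fx = x , here refl , sym fx⊓t≡fx
  ... | inj₂ fx⊓t≡t  = map₂ (Product.map there (λ fi≡t → trans fi≡t (sym fx⊓t≡t))) (minOver-attained xs eqᵣ)

minOver-cong : ∀ {A : Set} {f g : A → ℕ} xs → (∀ {i} → i ∈ xs → f i ≡ g i) → minOver f xs ≡ minOver g xs
minOver-cong []       _ = refl
minOver-cong (x ∷ xs) h = cong₂ _⊓∞_ (cong fin (h (here refl))) (minOver-cong xs (h ∘ there))

module _ {A : Set} where

  countᵇ : (A → Bool) → List A → ℕ
  countᵇ p []       = 0
  countᵇ p (x ∷ xs) = if p x then suc (countᵇ p xs) else countᵇ p xs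

  countᵇ-true : ∀ xs → countᵇ (λ _ → true) xs ≡ length xs
  countᵇ-true []       = refl
  countᵇ-true (x ∷ xs) = cong suc (countᵇ-true xs)

  countᵇ-none : ∀ {p} xs → (∀ {x} → x ∈ xs → ¬ T (p x)) → countᵇ p xs ≡ 0
  countᵇ-none []           _    = refl
  countᵇ-none {p} (x ∷ xs) none with p x | none (here refl)
  ... | true  | ¬px = ⊥-elim (¬px _)
  ... | false | _   = countᵇ-none xs (none ∘ there)

  countᵇ-mono : ∀ {p q} xs → (∀ x → T (p x) → T (q x)) → countᵇ p xs ≤ countᵇ q xs
  countᵇ-mono []               _   = z≤n
  countᵇ-mono {p} {q} (x ∷ xs) p⇒q with p x | q x | p⇒q x
  ... | true  | true  | _    = s≤s (countᵇ-mono xs p⇒q)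
  ... | true  | false | p⇒qx = ⊥-elim (p⇒qx _)
  ... | false | true  | _    = m≤n⇒m≤1+n (countᵇ-mono xs p⇒q)
  ... | false | false | _    = countᵇ-mono xs p⇒q

  countᵇ-filter : ∀ {ℓ} {P : A → Set ℓ} (P? : Decidable P) p xs →
                  countᵇ p (filter P? xs) ≡ countᵇ (λ x → does (P? x) ∧ p x) xs
  countᵇ-filter P? p []       = refl
  countᵇ-filter P? p (x ∷ xs) with does (P? x)
  ... | false = countᵇ-filter P? p xs
  ... | true with p x
  ...   | true  = cong suc (countᵇ-filter P? p xs)
  ...   | false = countᵇ-filter P? p xs

  countᵇ-↭ : ∀ p {xs ys} → xs ↭ ys → countᵇ p xs ≡ countᵇ p ys
  countᵇ-↭ p ↭-refl = refl
  countᵇ-↭ p (prep x xs↭ys) with p x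
  ... | true  = cong suc (countᵇ-↭ p xs↭ys)
  ... | false = countᵇ-↭ p xs↭ys
  countᵇ-↭ p (swap x y xs↭ys) with p x | p y
  ... | true  | true  = cong (λ k → suc (suc k)) (countᵇ-↭ p xs↭ys)
  ... | true  | false = cong suc (countᵇ-↭ p xs↭ys)
  ... | false | true  = cong suc (countᵇ-↭ p xs↭ys)
  ... | false | false = countᵇ-↭ p xs↭ys
  countᵇ-↭ p (↭-trans xs↭ys ys↭zs) = trans (countᵇ-↭ p xs↭ys) (countᵇ-↭ p ys↭zs)

  pigeonhole : ∀ p q xs → countᵇ q xs < countᵇ p xs → ∃[ x ] (x ∈ xs × T (p x) × ¬ T (q x))
  pigeonhole p q (x ∷ xs) q<p with p x in px | q x in qx
  ... | true  | false = x , here refl , subst T (sym px) _ , subst T qx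
  ... | true  | true  = map₂ (map₁ there) (pigeonhole p q xs (s≤s⁻¹ q<p))
  ... | false | true  = map₂ (map₁ there) (pigeonhole p q xs (<-trans (n<1+n _) q<p))
  ... | false | false = map₂ (map₁ there) (pigeonhole p q xs q<p)

countᵇ-map : ∀ {A B : Set} (p : B → Bool) (f : A → B) xs → countᵇ p (map f xs) ≡ countᵇ (p ∘ f) xs
countᵇ-map p f []       = refl
countᵇ-map p f (x ∷ xs) with p (f x)
... | true  = cong suc (countᵇ-map p f xs)
... | false = countᵇ-map p f xs

filter-map : ∀ {A B : Set} {ℓ} {P : B → Set ℓ} (P? : Decidable P) (f : A → B) xs →
             filter P? (map f xs) ≡ map f (filter (P? ∘ f) xs)
filter-map P? f []       = refl
filter-map P? f (x ∷ xs) with does (P? (f x))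
... | true  = cong (f x ∷_) (filter-map P? f xs)
... | false = filter-map P? f xs

Unique-∷ʳ⁻ : ∀ {A : Set} (xs : List A) {w} → Unique (xs ∷ʳ w) → Unique xs × w ∉ xs
Unique-∷ʳ⁻ []       _             = [] , λ ()
Unique-∷ʳ⁻ (x ∷ xs) (x∉ ∷ unique) with Unique-∷ʳ⁻ xs unique | All.++⁻ xs x∉
... | uniqueₓₛ , w∉xs | x∉xs , x≢w All.∷ _ =
      x∉xs ∷ uniqueₓₛ , λ { (here w≡x) → x≢w (sym w≡x) ; (there w∈xs) → w∉xs w∈xs }

head-≤ : ∀ {x y xs} → Sorted (x ∷ xs) → y ∈ x ∷ xs → x ≤ y
head-≤ _               (here refl) = ≤-refl
head-≤ (x≤x′ ∷ sorted) (there y∈)  = ≤-trans x≤x′ (head-≤ sorted y∈)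

∣tabulate∣≡countᵇ : ∀ {A : Set} {n} (p : A → Bool) (f : Fin n → A) →
                    ∣ Vec.tabulate (p ∘ f) ∣ ≡ countᵇ p (tabulate f)
∣tabulate∣≡countᵇ {n = zero}  p f = refl
∣tabulate∣≡countᵇ {n = suc n} p f with p (f zero)
... | true  = cong suc (∣tabulate∣≡countᵇ p (f ∘ suc))
... | false = ∣tabulate∣≡countᵇ p (f ∘ suc)

∣p∣≡countᵇ-allFin : ∀ {n} (p : Subset n) → ∣ p ∣ ≡ countᵇ (lookup p) (allFin n)
∣p∣≡countᵇ-allFin p = trans (cong ∣_∣ (sym (tabulate∘lookup p))) (∣tabulate∣≡countᵇ (lookup p) (λ i → i))

∣p∪q∣≤∣p∣+∣q∣ : ∀ {n} (p q : Subset n) → ∣ p ∪ q ∣ ≤ ∣ p ∣ + ∣ q ∣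
∣p∪q∣≤∣p∣+∣q∣ Vec.[]          Vec.[]          = z≤n
∣p∪q∣≤∣p∣+∣q∣ (true Vec.∷ p)  (y Vec.∷ q)     =
  s≤s (≤-trans (∣p∪q∣≤∣p∣+∣q∣ p q) (+-monoʳ-≤ ∣ p ∣ (∣p∣≤∣x∷p∣ y q)))
∣p∪q∣≤∣p∣+∣q∣ (false Vec.∷ p) (true Vec.∷ q)  =
  ≤-trans (s≤s (∣p∪q∣≤∣p∣+∣q∣ p q)) (≤-reflexive (sym (+-suc ∣ p ∣ ∣ q ∣)))
∣p∪q∣≤∣p∣+∣q∣ (false Vec.∷ p) (false Vec.∷ q) = ∣p∪q∣≤∣p∣+∣q∣ p q

∣p─q∣+∣p∩q∣≡∣p∣ : ∀ {n} (p q : Subset n) → ∣ p ─ q ∣ + ∣ p ∩ q ∣ ≡ ∣ p ∣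
∣p─q∣+∣p∩q∣≡∣p∣ Vec.[]          Vec.[]          = refl
∣p─q∣+∣p∩q∣≡∣p∣ (true Vec.∷ p)  (true Vec.∷ q)  =
  trans (+-suc ∣ p ─ q ∣ ∣ p ∩ q ∣) (cong suc (∣p─q∣+∣p∩q∣≡∣p∣ p q))
∣p─q∣+∣p∩q∣≡∣p∣ (true Vec.∷ p)  (false Vec.∷ q) = cong suc (∣p─q∣+∣p∩q∣≡∣p∣ p q)
∣p─q∣+∣p∩q∣≡∣p∣ (false Vec.∷ p) (true Vec.∷ q)  = ∣p─q∣+∣p∩q∣≡∣p∣ p q
∣p─q∣+∣p∩q∣≡∣p∣ (false Vec.∷ p) (false Vec.∷ q) = ∣p─q∣+∣p∩q∣≡∣p∣ p q

lookup-─-outside : ∀ {n} (p q : Subset n) i → lookup q i ≡ false → lookup (p ─ q) i ≡ lookup p i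
lookup-─-outside (x Vec.∷ p) (y Vec.∷ q) zero    refl = refl
lookup-─-outside (x Vec.∷ p) (y Vec.∷ q) (suc i) i∉q  = lookup-─-outside p q i i∉q

lookup-─-inside : ∀ {n} (p q : Subset n) i → lookup q i ≡ true → lookup (p ─ q) i ≡ false
lookup-─-inside (x Vec.∷ p) (y Vec.∷ q) zero    refl = refl
lookup-─-inside (x Vec.∷ p) (y Vec.∷ q) (suc i) i∈q  = lookup-─-inside p q i i∈q

module _ {n m : ℕ} (G : TemporalGraph n m) (δ : ℕ) where

  nth∞-∈ : ∀ xs k {z} → nth∞ G δ xs k ≡ fin z → z ∈ xs
  nth∞-∈ (x ∷ xs) zero    refl = here refl
  nth∞-∈ (x ∷ xs) (suc k) eq   = there (nth∞-∈ xs k eq)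

  nth∞≡∞⇒length≤ : ∀ xs k → nth∞ G δ xs k ≡ ∞ → length xs ≤ k
  nth∞≡∞⇒length≤ []       k       _  = z≤n
  nth∞≡∞⇒length≤ (x ∷ xs) (suc k) eq = s≤s (nth∞≡∞⇒length≤ xs k eq)

  plusδ-nth∞-0-≤ : ∀ {xs y} → Sorted xs → y ∈ xs → plusδ G δ (nth∞ G δ xs 0) ≤∞ fin (y + δ)
  plusδ-nth∞-0-≤ {x ∷ xs} sorted y∈ = fin≤fin (+-monoˡ-≤ δ (head-≤ sorted y∈))

  nth∞<countᵇ-≤ : ∀ xs k {z} → Sorted xs → nth∞ G δ xs k ≡ fin z → k < countᵇ (_≤ᵇ z) xs
  nth∞<countᵇ-≤ (x ∷ xs) k {z} sorted eq with x ≤ᵇ z in x≤ᵇz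
  ... | false = ⊥-elim (subst T x≤ᵇz (≤⇒≤ᵇ (head-≤ sorted (nth∞-∈ (x ∷ xs) k eq))))
  ... | true  = s≤s (tail-bound k eq)
    where
    tail-bound : ∀ k → nth∞ G δ (x ∷ xs) k ≡ fin z → k ≤ countᵇ (_≤ᵇ z) xs
    tail-bound zero    _  = z≤n
    tail-bound (suc k) eq = nth∞<countᵇ-≤ xs k (Sorted-tail sorted) eq

  countᵇ-<ᵇ∞-nth∞ : ∀ xs k → Sorted xs → countᵇ (_<ᵇ∞ nth∞ G δ xs k) xs ≤ k
  countᵇ-<ᵇ∞-nth∞ xs k sorted with nth∞ G δ xs k in eq
  ... | ∞     = ≤-trans (≤-reflexive (countᵇ-true xs)) (nth∞≡∞⇒length≤ xs k eq)
  ... | fin z = below xs k sorted eq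
    where
    below : ∀ ys k → Sorted ys → nth∞ G δ ys k ≡ fin z → countᵇ (_<ᵇ z) ys ≤ k
    below (y ∷ ys) zero    sorted refl =
      ≤-reflexive (countᵇ-none (y ∷ ys) (λ y′∈ y′<y → <⇒≱ (<ᵇ⇒< _ _ y′<y) (head-≤ sorted y′∈)))
    below (y ∷ ys) (suc k) sorted eq with y <ᵇ z
    ... | true  = s≤s (below ys k (Sorted-tail sorted) eq)
    ... | false = m≤n⇒m≤1+n (below ys k (Sorted-tail sorted) eq)

  arrivalTime : Fin m → ℕ
  arrivalTime i = time (arcs G i) + trav (arcs G i)

  -- delayedArr G δ D is definitionally arrivalUnder (lookup D).
  arrivalUnder : (Fin m → Bool) → Fin m → ℕ
  arrivalUnder d i = arrivalTime i + (if d i then δ else 0)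

  arrivalUnder-≤ : ∀ d i → arrivalUnder d i ≤ arrivalTime i + δ
  arrivalUnder-≤ d i with d i
  ... | true  = ≤-refl
  ... | false = +-monoʳ-≤ (arrivalTime i) z≤n

  arrivalUnder-delayed : ∀ d {i} → T (d i) → arrivalUnder d i ≡ arrivalTime i + δ
  arrivalUnder-delayed d {i} di with d i
  ... | true = refl

  arrivalUnder-undelayed : ∀ d {i} → ¬ T (d i) → arrivalUnder d i ≡ arrivalTime i
  arrivalUnder-undelayed d {i} ¬di with d i
  ... | true  = ⊥-elim (¬di _)
  ... | false = +-identityʳ (arrivalTime i)

  -- aFun G δ u w (fin t) k is definitionally aOfTimes (arrTimes G δ u w t) k.
  aOfTimes : List ℕ → ℕ → ℕ∞
  aOfTimes xs k = plusδ G δ (nth∞ G δ xs 0) ⊓∞ nth∞ G δ xs k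

  module _ {C : List (Fin m)} {s : List ℕ} (s↭C : s ↭ map arrivalTime C) (sorted : Sorted s) where

    minOver-arrivalUnder-≤ : ∀ d k → countᵇ d C ≤ k → minOver (arrivalUnder d) C ≤∞ aOfTimes s k
    minOver-arrivalUnder-≤ d k d≤k = ⊓∞-glb first kth
      where
      first : minOver (arrivalUnder d) C ≤∞ plusδ G δ (nth∞ G δ s 0)
      first with nth∞ G δ s 0 in eq
      ... | ∞     = _ ≤∞∞
      ... | fin x with ∈-map⁻ arrivalTime (∈-resp-↭ s↭C (nth∞-∈ s 0 eq))
      ...   | i , i∈C , refl = ≤∞-trans (minOver-lb _ i∈C) (fin≤fin (arrivalUnder-≤ d i))
      -- more than k arcs of C arrive by z, and at most k of them are delayed
      kth : minOver (arrivalUnder d) C ≤∞ nth∞ G δ s k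
      kth with nth∞ G δ s k in eq
      ... | ∞     = _ ≤∞∞
      ... | fin z with pigeonhole (λ i → arrivalTime i ≤ᵇ z) d C
                         (≤-<-trans d≤k (<-≤-trans (nth∞<countᵇ-≤ s k sorted eq)
                           (≤-reflexive (trans (countᵇ-↭ _ s↭C) (countᵇ-map _ arrivalTime C)))))
      ...   | i , i∈C , early , undelayed =
              ≤∞-trans (minOver-lb _ i∈C)
                (fin≤fin (subst (_≤ z) (sym (arrivalUnder-undelayed d undelayed)) (≤ᵇ⇒≤ _ _ early)))

    earlyArcs : ℕ → Fin m → Bool
    earlyArcs k i = arrivalTime i <ᵇ∞ nth∞ G δ s k

    countᵇ-earlyArcs : ∀ k → countᵇ (earlyArcs k) C ≤ k
    countᵇ-earlyArcs k =
      ≤-trans (≤-reflexive (sym (trans (countᵇ-↭ _ s↭C) (countᵇ-map _ arrivalTime C))))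
              (countᵇ-<ᵇ∞-nth∞ s k sorted)

    minOver-arrivalUnder-earlyArcs : ∀ k → minOver (arrivalUnder (earlyArcs k)) C ≡ aOfTimes s k
    minOver-arrivalUnder-earlyArcs k =
      ≤∞-antisym (minOver-arrivalUnder-≤ (earlyArcs k) k (countᵇ-earlyArcs k)) (minOver-glb _ C lower)
      where
      lower : ∀ {i} → i ∈ C → aOfTimes s k ≤∞ fin (arrivalUnder (earlyArcs k) i)
      lower {i} i∈C with T? (earlyArcs k i)
      ... | yes early = subst (λ a → aOfTimes s k ≤∞ fin a) (sym (arrivalUnder-delayed (earlyArcs k) early))
                          (≤∞-trans (x⊓∞y≤∞x _ _)
                            (plusδ-nth∞-0-≤ sorted (∈-resp-↭ (↭-sym s↭C) (∈-map⁺ arrivalTime i∈C))))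
      ... | no late   = subst (λ a → aOfTimes s k ≤∞ fin a) (sym (arrivalUnder-undelayed (earlyArcs k) late))
                          (≤∞-trans (x⊓∞y≤∞y _ _) (≮ᵇ∞⇒≥ (nth∞ G δ s k) late))

  Candidates : Fin n → Fin n → ℕ → List (Fin m)
  Candidates u w t = filter (λ i → start (arcs G i) ≟ u)
                       (filter (λ i → end (arcs G i) ≟ w)
                         (filter (λ i → t ≤? time (arcs G i)) (allFin m)))

  ∈-Candidates⁻ : ∀ {u w t i} → i ∈ Candidates u w t →
                  start (arcs G i) ≡ u × end (arcs G i) ≡ w × t ≤ time (arcs G i)
  ∈-Candidates⁻ {u} {w} {t} i∈ =
    let i∈₂ , s≡u = ∈-filter⁻ (λ i → start (arcs G i) ≟ u) {xs = filter _ (filter _ (allFin m))} i∈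
        i∈₁ , e≡w = ∈-filter⁻ (λ i → end (arcs G i) ≟ w) {xs = filter _ (allFin m)} i∈₂
        _   , t≤  = ∈-filter⁻ (λ i → t ≤? time (arcs G i)) {xs = allFin m} i∈₁
    in s≡u , e≡w , t≤

  ∈-Candidates⁺ : ∀ {u w t i} → start (arcs G i) ≡ u → end (arcs G i) ≡ w → t ≤ time (arcs G i) →
                  i ∈ Candidates u w t
  ∈-Candidates⁺ {u} {w} {t} {i} s≡u e≡w t≤ =
    ∈-filter⁺ (λ i → start (arcs G i) ≟ u)
      (∈-filter⁺ (λ i → end (arcs G i) ≟ w)
        (∈-filter⁺ (λ i → t ≤? time (arcs G i)) (∈-allFin i) t≤) e≡w) s≡u

  arrTimes≡sort-Candidates : ∀ u w t → arrTimes G δ u w t ≡ sort (map arrivalTime (Candidates u w t))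
  arrTimes≡sort-Candidates u w t = cong sort (begin
    map arrivalOf (filter S? (filter E? (filter L? (map (arcs G) (allFin m)))))
      ≡⟨ cong (map arrivalOf ∘ filter S? ∘ filter E?) (filter-map L? (arcs G) (allFin m)) ⟩
    map arrivalOf (filter S? (filter E? (map (arcs G) L₁)))
      ≡⟨ cong (map arrivalOf ∘ filter S?) (filter-map E? (arcs G) L₁) ⟩
    map arrivalOf (filter S? (map (arcs G) L₂))
      ≡⟨ cong (map arrivalOf) (filter-map S? (arcs G) L₂) ⟩
    map arrivalOf (map (arcs G) (Candidates u w t))
      ≡⟨ map-∘ (Candidates u w t) ⟨
    map arrivalTime (Candidates u w t) ∎)
    where
    open ≡-Reasoning
    arrivalOf : Arc n → ℕ
    arrivalOf e = time e + trav e
    S? E? L? : Decidable {A = Arc n} _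
    S? e = start e ≟ u
    E? e = end e ≟ w
    L? e = t ≤? time e
    L₁ = filter (λ i → t ≤? time (arcs G i)) (allFin m)
    L₂ = filter (λ i → end (arcs G i) ≟ w) L₁

  arrTimes↭Candidates : ∀ u w t → arrTimes G δ u w t ↭ map arrivalTime (Candidates u w t)
  arrTimes↭Candidates u w t =
    subst (_↭ map arrivalTime (Candidates u w t)) (sym (arrTimes≡sort-Candidates u w t)) (sort-↭ _)

  arrTimes-sorted : ∀ u w t → Sorted (arrTimes G δ u w t)
  arrTimes-sorted u w t = sort-↗ _

  -- The conjuncts mirror the nesting of the filters in Candidates, so that
  -- countᵇ-Candidates follows from countᵇ-filter alone.
  onCandidates : Fin n → Fin n → ℕ → (Fin m → Bool) → Fin m → Bool
  onCandidates u w t d i =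
    does (t ≤? time (arcs G i)) ∧ (does (end (arcs G i) ≟ w) ∧ (does (start (arcs G i) ≟ u) ∧ d i))

  countᵇ-Candidates : ∀ u w t d → countᵇ d (Candidates u w t) ≡ countᵇ (onCandidates u w t d) (allFin m)
  countᵇ-Candidates u w t d =
    trans (countᵇ-filter (λ i → start (arcs G i) ≟ u) d L₂)
      (trans (countᵇ-filter (λ i → end (arcs G i) ≟ w) _ L₁)
        (countᵇ-filter (λ i → t ≤? time (arcs G i)) _ (allFin m)))
    where
    L₁ = filter (λ i → t ≤? time (arcs G i)) (allFin m)
    L₂ = filter (λ i → end (arcs G i) ≟ w) L₁

  onCandidates-∈ : ∀ {u w t} d {i} → i ∈ Candidates u w t → onCandidates u w t d i ≡ d i
  onCandidates-∈ {u} {w} {t} d {i} i∈ with ∈-Candidates⁻ i∈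
  ... | s≡u , e≡w , t≤ rewrite dec-true (t ≤? time (arcs G i)) t≤ | dec-true (end (arcs G i) ≟ w) e≡w
                             | dec-true (start (arcs G i) ≟ u) s≡u = refl

  onCandidates-≢ : ∀ u w t d {i} → end (arcs G i) ≢ w → onCandidates u w t d i ≡ false
  onCandidates-≢ u w t d {i} e≢w rewrite dec-false (end (arcs G i) ≟ w) e≢w =
    ∧-zeroʳ (does (t ≤? time (arcs G i)))

  onCandidates-T : ∀ u w t d {i} → T (onCandidates u w t d i) → end (arcs G i) ≡ w × T (d i)
  onCandidates-T u w t d {i} cand with t ≤ᵇ time (arcs G i) | end (arcs G i) ≟ w | start (arcs G i) ≟ u
  ... | true  | yes e≡w | yes _ = e≡w , cand
  ... | true  | yes _   | no _  = ⊥-elim cand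
  ... | true  | no _    | _     = ⊥-elim cand
  ... | false | _       | _     = ⊥-elim cand

  arcsInto : Fin n → Subset m
  arcsInto w = Vec.tabulate (λ i → does (end (arcs G i) ≟ w))

  lookup-arcsInto-≡ : ∀ {w i} → end (arcs G i) ≡ w → lookup (arcsInto w) i ≡ true
  lookup-arcsInto-≡ {w} {i} e≡w = trans (lookup∘tabulate _ i) (dec-true (end (arcs G i) ≟ w) e≡w)

  lookup-arcsInto-≢ : ∀ {w i} → end (arcs G i) ≢ w → lookup (arcsInto w) i ≡ false
  lookup-arcsInto-≢ {w} {i} e≢w = trans (lookup∘tabulate _ i) (dec-false (end (arcs G i) ≟ w) e≢w)

  lookup-∩-arcsInto : ∀ D {w i} → end (arcs G i) ≡ w → lookup (D ∩ arcsInto w) i ≡ lookup D i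
  lookup-∩-arcsInto D {w} {i} e≡w = begin
    lookup (D ∩ arcsInto w) i           ≡⟨ lookup-zipWith _∧_ i D (arcsInto w) ⟩
    lookup D i ∧ lookup (arcsInto w) i  ≡⟨ cong (lookup D i ∧_) (lookup-arcsInto-≡ e≡w) ⟩
    lookup D i ∧ true                   ≡⟨ ∧-identityʳ (lookup D i) ⟩
    lookup D i                          ∎
    where open ≡-Reasoning

  countᵇ-Candidates-≤ : ∀ D u w t → countᵇ (lookup D) (Candidates u w t) ≤ ∣ D ∩ arcsInto w ∣
  countᵇ-Candidates-≤ D u w t = begin
    countᵇ (lookup D) (Candidates u w t)                 ≡⟨ countᵇ-Candidates u w t (lookup D) ⟩
    countᵇ (onCandidates u w t (lookup D)) (allFin m)    ≤⟨ countᵇ-mono (allFin m) delayedInto ⟩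
    countᵇ (lookup (D ∩ arcsInto w)) (allFin m)          ≡⟨ ∣p∣≡countᵇ-allFin (D ∩ arcsInto w) ⟨
    ∣ D ∩ arcsInto w ∣                                   ∎
    where
    open ≤-Reasoning
    delayedInto : ∀ i → T (onCandidates u w t (lookup D) i) → T (lookup (D ∩ arcsInto w) i)
    delayedInto i cand with onCandidates-T u w t (lookup D) cand
    ... | e≡w , delayed = subst T (sym (lookup-∩-arcsInto D e≡w)) delayed

  earliestHop : Subset m → Fin n → Fin n → ℕ∞ → ℕ∞
  earliestHop D u w ∞       = ∞
  earliestHop D u w (fin t) = minOver (delayedArr G δ D) (Candidates u w t)

  earliestHop-≤-arc : ∀ D {u w τ i} → start (arcs G i) ≡ u → end (arcs G i) ≡ w → τ ≤∞ fin (time (arcs G i)) →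
                      earliestHop D u w τ ≤∞ fin (delayedArr G δ D i)
  earliestHop-≤-arc D s≡u e≡w (fin≤fin t≤) = minOver-lb _ (∈-Candidates⁺ s≡u e≡w t≤)

  earliestHop-mono : ∀ D u w {τ τ′} → τ ≤∞ τ′ → earliestHop D u w τ ≤∞ earliestHop D u w τ′
  earliestHop-mono D u w (_ ≤∞∞)        = _ ≤∞∞
  earliestHop-mono D u w (fin≤fin t≤t′) = minOver-⊇ _ (Candidates u w _) λ i∈ →
    let s≡u , e≡w , t′≤ = ∈-Candidates⁻ i∈ in ∈-Candidates⁺ s≡u e≡w (≤-trans t≤t′ t′≤)

  earliestHop-local : ∀ {D D′} u w τ → (∀ i → end (arcs G i) ≡ w → lookup D i ≡ lookup D′ i) →
                      earliestHop D u w τ ≡ earliestHop D′ u w τ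
  earliestHop-local u w ∞       _     = refl
  earliestHop-local u w (fin t) agree = minOver-cong (Candidates u w t) λ {i} i∈ →
    cong (λ b → arrivalTime i + (if b then δ else 0)) (agree i (proj₁ (proj₂ (∈-Candidates⁻ i∈))))

  earliestHop-≤-aFun : ∀ D u w τ k → ∣ D ∩ arcsInto w ∣ ≤ k → earliestHop D u w τ ≤∞ aFun G δ u w τ k
  earliestHop-≤-aFun D u w ∞       k _     = _ ≤∞∞
  earliestHop-≤-aFun D u w (fin t) k bound =
    minOver-arrivalUnder-≤ (arrTimes↭Candidates u w t) (arrTimes-sorted u w t) (lookup D) k
      (≤-trans (countᵇ-Candidates-≤ D u w t) bound)

  aFun-attained : ∀ u w τ k → ∃[ D ] (∣ D ∣ ≤ k × (∀ i → end (arcs G i) ≢ w → lookup D i ≡ false)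
                                      × earliestHop D u w τ ≡ aFun G δ u w τ k)
  aFun-attained u w ∞       k =
    ⊥ , subst (_≤ k) (sym (∣⊥∣≡0 m)) z≤n , (λ i _ → lookup-replicate i false) , refl
  aFun-attained u w (fin t) k =
    Vec.tabulate d , size , (λ i e≢w → trans (lookup∘tabulate d i) (onCandidates-≢ u w t early e≢w)) , value
    where
    C = Candidates u w t
    s↭C = arrTimes↭Candidates u w t
    sorted = arrTimes-sorted u w t
    early = earlyArcs s↭C sorted k
    d = onCandidates u w t early
    size : ∣ Vec.tabulate d ∣ ≤ k
    size = ≤-trans (≤-reflexive (trans (∣tabulate∣≡countᵇ d (λ i → i)) (sym (countᵇ-Candidates u w t early))))
                   (countᵇ-earlyArcs s↭C sorted k)
    value : minOver (delayedArr G δ (Vec.tabulate d)) C ≡ aFun G δ u w (fin t) k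
    value = trans (minOver-cong C (λ {i} i∈ → cong (λ b → arrivalTime i + (if b then δ else 0))
                                                (trans (lookup∘tabulate d i) (onCandidates-∈ early i∈))))
                  (minOver-arrivalUnder-earlyArcs s↭C sorted k)

  -- a(u,w,τ,k) is the hop from τ under some delay set of size at most k.
  aFun-mono : ∀ u w {τ τ′ k k′} → τ ≤∞ τ′ → k ≤ k′ → aFun G δ u w τ k ≤∞ aFun G δ u w τ′ k′
  aFun-mono u w {τ} {τ′} {k} {k′} τ≤τ′ k≤k′ with aFun-attained u w τ k
  ... | D , ∣D∣≤k , _ , hop≡a = subst (_≤∞ aFun G δ u w τ′ k′) hop≡a
          (≤∞-trans (earliestHop-mono D u w τ≤τ′)
                    (earliestHop-≤-aFun D u w τ′ k′
                      (≤-trans (∣p∩q∣≤∣p∣ D (arcsInto w)) (≤-trans ∣D∣≤k k≤k′))))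

  maxUpTo-ub : ∀ (f : ℕ → ℕ∞) y {y′} → y′ ≤ y → f y′ ≤∞ maxUpTo G δ y f
  maxUpTo-ub f zero    z≤n = ≤∞-refl
  maxUpTo-ub f (suc y) y′≤ with m≤n⇒m<n∨m≡n y′≤
  ... | inj₁ y′<1+y = ≤∞-trans (maxUpTo-ub f y (s≤s⁻¹ y′<1+y)) (x≤∞x⊔∞y _ _)
  ... | inj₂ refl   = y≤∞x⊔∞y _ _

  maxUpTo-attained : ∀ (f : ℕ → ℕ∞) y → ∃[ y′ ] (y′ ≤ y × maxUpTo G δ y f ≡ f y′)
  maxUpTo-attained f zero    = 0 , z≤n , refl
  maxUpTo-attained f (suc y) with ⊔∞-sel (maxUpTo G δ y f) (f (suc y))
  ... | inj₂ eq = suc y , ≤-refl , eq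
  ... | inj₁ eq with maxUpTo-attained f y
  ...   | y′ , y′≤y , eq′ = y′ , m≤n⇒m≤1+n y′≤y , trans eq eq′

  lastOf : Fin n → List (Fin n) → Fin n
  lastOf v []       = v
  lastOf v (x ∷ xs) = lastOf x xs

  earliestFrom : Subset m → ℕ∞ → Fin n → List (Fin n) → ℕ∞
  earliestFrom D τ u []       = τ
  earliestFrom D τ u (w ∷ ws) = earliestFrom D (earliestHop D u w τ) w ws

  earliestArrival : Subset m → Fin n → List (Fin n) → ℕ∞
  earliestArrival D v vs = earliestFrom D (fin 0) v vs

  earliestFrom-∷ʳ : ∀ D τ u vs w →
                    earliestFrom D τ u (vs ∷ʳ w) ≡ earliestHop D (lastOf u vs) w (earliestFrom D τ u vs)
  earliestFrom-∷ʳ D τ u []       w = refl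
  earliestFrom-∷ʳ D τ u (x ∷ xs) w = earliestFrom-∷ʳ D (earliestHop D u x τ) x xs w

  earliestFrom-local : ∀ {D D′} τ u vs → (∀ i → end (arcs G i) ∈ vs → lookup D i ≡ lookup D′ i) →
                       earliestFrom D τ u vs ≡ earliestFrom D′ τ u vs
  earliestFrom-local τ u []       _     = refl
  earliestFrom-local {D} {D′} τ u (w ∷ ws) agree =
    trans (cong (λ τ′ → earliestFrom D τ′ w ws) (earliestHop-local u w τ (λ i e≡w → agree i (here e≡w))))
          (earliestFrom-local (earliestHop D′ u w τ) w ws (λ i i∈ → agree i (there i∈)))

  tableFrom-∷ʳ : ∀ f u vs w y → tableFrom G δ f u (vs ∷ʳ w) y
                 ≡ maxUpTo G δ y (λ y′ → aFun G δ (lastOf u vs) w (tableFrom G δ f u vs y′) (y ∸ y′))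
  tableFrom-∷ʳ f u []       w y = refl
  tableFrom-∷ʳ f u (x ∷ xs) w y =
    tableFrom-∷ʳ (λ y′ → maxUpTo G δ y′ (λ y″ → aFun G δ u x (f y″) (y′ ∸ y″))) x xs w y

  walkArr-∷ʳ : ∀ D es i → walkArr G δ D (es ∷ʳ i) ≡ delayedArr G δ D i
  walkArr-∷ʳ D []           i = refl
  walkArr-∷ʳ D (j ∷ [])     i = refl
  walkArr-∷ʳ D (j ∷ k ∷ es) i = walkArr-∷ʳ D (k ∷ es) i

  DelayedWalk-∷ʳ⁻ : ∀ D es i → DelayedWalk G δ D (es ∷ʳ i) →
                    DelayedWalk G δ D es × walkArr G δ D es ≤ time (arcs G i)
  DelayedWalk-∷ʳ⁻ D []           i _                 = [] , z≤n
  DelayedWalk-∷ʳ⁻ D (j ∷ [])     i ((_ , arr≤) ∷ _) = [ j ] , arr≤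
  DelayedWalk-∷ʳ⁻ D (j ∷ k ∷ es) i (link ∷ walk)    = map₁ (link ∷_) (DelayedWalk-∷ʳ⁻ D (k ∷ es) i walk)

  Follows-∷ʳ⁻ : ∀ {v} vs {w es} → Follows G δ es (v ∷ (vs ∷ʳ w)) →
                ∃[ es′ ] ∃[ i ] (es ≡ es′ ∷ʳ i × Follows G δ es′ (v ∷ vs)
                                 × start (arcs G i) ≡ lastOf v vs × end (arcs G i) ≡ w)
  Follows-∷ʳ⁻ {v} []       (step {i} s≡ e≡ (single _)) = [] , i , refl , single v , s≡ , e≡
  Follows-∷ʳ⁻     (x ∷ xs) (step {i₀} s≡ e≡ follows) with Follows-∷ʳ⁻ xs follows
  ... | es′ , i , refl , follows′ , s≡′ , e≡′ = i₀ ∷ es′ , i , refl , step s≡ e≡ follows′ , s≡′ , e≡′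

  walk-∷ʳ⁺ : ∀ D {v vs es i w} → DelayedWalk G δ D es → Follows G δ es (v ∷ vs) →
             start (arcs G i) ≡ lastOf v vs → end (arcs G i) ≡ w → walkArr G δ D es ≤ time (arcs G i) →
             DelayedWalk G δ D (es ∷ʳ i) × Follows G δ (es ∷ʳ i) (v ∷ (vs ∷ʳ w))
  walk-∷ʳ⁺ D {i = i} {w} _     (single v)                 s≡ e≡ _    = [ i ] , step s≡ e≡ (single w)
  walk-∷ʳ⁺ D {i = i} {w} [ j ] (step s≡₀ e≡₀ (single _)) s≡ e≡ arr≤ =
    ((trans e≡₀ (sym s≡) , arr≤) ∷ [ i ]) , step s≡₀ e≡₀ (step s≡ e≡ (single w))
  walk-∷ʳ⁺ D (link ∷ walk) (step s≡₀ e≡₀ follows) s≡ e≡ arr≤ =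
    Product.map (link ∷_) (step s≡₀ e≡₀) (walk-∷ʳ⁺ D walk follows s≡ e≡ arr≤)

  earliestArrival-≤-walk : ∀ D v vs {es} → DelayedWalk G δ D es → Follows G δ es (v ∷ vs) →
                           earliestArrival D v vs ≤∞ fin (walkArr G δ D es)
  earliestArrival-≤-walk D v vs = go (reverseView vs)
    where
    go : ∀ {vs es} → Reverse vs → DelayedWalk G δ D es → Follows G δ es (v ∷ vs) →
         earliestArrival D v vs ≤∞ fin (walkArr G δ D es)
    go []              _    _       = fin≤fin z≤n
    go (xs ∶ rv ∶ʳ w) walk follows with Follows-∷ʳ⁻ xs follows
    ... | es′ , i , refl , follows′ , s≡ , e≡ with DelayedWalk-∷ʳ⁻ D es′ i walk
    ...   | walk′ , arr≤ =
            subst₂ _≤∞_ (sym (earliestFrom-∷ʳ D (fin 0) v xs w)) (cong fin (sym (walkArr-∷ʳ D es′ i)))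
              (earliestHop-≤-arc D s≡ e≡ (≤∞-trans (go rv walk′ follows′) (fin≤fin arr≤)))

  earliestArrival-realised : ∀ D v vs {t} → earliestArrival D v vs ≡ fin t →
                             ∃[ es ] (DelayedWalk G δ D es × Follows G δ es (v ∷ vs) × walkArr G δ D es ≡ t)
  earliestArrival-realised D v vs = go (reverseView vs)
    where
    go : ∀ {vs t} → Reverse vs → earliestArrival D v vs ≡ fin t →
         ∃[ es ] (DelayedWalk G δ D es × Follows G δ es (v ∷ vs) × walkArr G δ D es ≡ t)
    go [] refl = [] , [] , single v , refl
    go {t = t} (xs ∶ rv ∶ʳ w) eq = extend _ refl (trans (sym (earliestFrom-∷ʳ D (fin 0) v xs w)) eq)
      where
      extend : ∀ τ → earliestArrival D v xs ≡ τ → earliestHop D (lastOf v xs) w τ ≡ fin t →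
               ∃[ es ] (DelayedWalk G δ D es × Follows G δ es (v ∷ (xs ∷ʳ w)) × walkArr G δ D es ≡ t)
      extend (fin t₀) eq₀ hop≡ with minOver-attained _ _ hop≡ | go rv eq₀
      ... | i , i∈ , arr≡ | es′ , walk′ , follows′ , arr′ =
            let s≡ , e≡ , t₀≤ = ∈-Candidates⁻ i∈
                walk , follows = walk-∷ʳ⁺ D walk′ follows′ s≡ e≡ (subst (_≤ time (arcs G i)) (sym arr′) t₀≤)
            in es′ ∷ʳ i , walk , follows , trans (walkArr-∷ʳ D es′ i) arr≡

  walk⇔finite : ∀ D v vs →
                (∃[ es ] (DelayedWalk G δ D es × Follows G δ es (v ∷ vs))) ⇔ IsFinite (earliestArrival D v vs)
  walk⇔finite D v vs = mk⇔
    (λ (es , walk , follows) → ≤∞fin⇒finite (earliestArrival-≤-walk D v vs walk follows))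
    (λ (t , eq) → let es , walk , follows , _ = earliestArrival-realised D v vs eq in es , walk , follows)

  ends-Follows : ∀ {es v R} → Follows G δ es (v ∷ R) → map (λ j → end (arcs G j)) es ≡ R
  ends-Follows (single v)          = refl
  ends-Follows (step _ e≡ follows) = cong₂ _∷_ e≡ (ends-Follows follows)

  Follows⇒IsPath : ∀ {es R} → Unique R → Follows G δ es R → IsPath G δ es
  Follows⇒IsPath _      (single v)           = []
  Follows⇒IsPath unique (step s≡ e≡ follows) =
    subst Unique (sym (cong₂ _∷_ s≡ (cong₂ _∷_ e≡ (ends-Follows follows)))) unique

  earliestArrival-correct : ∀ D v vs → Unique (v ∷ vs) →
                            EarliestArrival G δ D (v ∷ vs) (earliestArrival D v vs)
  earliestArrival-correct D v []       _      = refl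
  earliestArrival-correct D v (w ∷ ws) unique with earliestArrival D v (w ∷ ws) in eq
  ... | ∞     = inj₁ (refl , λ es (walk , _ , follows) → ∞≰fin (subst (_≤∞ _) eq (lowerBound walk follows)))
    where lowerBound = earliestArrival-≤-walk D v (w ∷ ws)
  ... | fin t with earliestArrival-realised D v (w ∷ ws) eq
  ...   | es , walk , follows , arr =
          inj₂ (t , refl , (es , (walk , Follows⇒IsPath unique follows , follows) , arr) ,
                λ es′ (walk′ , _ , follows′) →
                  fin≤fin⁻ (subst (_≤∞ _) eq (earliestArrival-≤-walk D v (w ∷ ws) walk′ follows′)))

  EarliestArrival-unique : ∀ D R {x y} → EarliestArrival G δ D R x → EarliestArrival G δ D R y → x ≡ y
  EarliestArrival-unique D []          refl refl = refl
  EarliestArrival-unique D (v ∷ [])    refl refl = refl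
  EarliestArrival-unique D (v ∷ w ∷ R) (inj₁ (refl , _)) (inj₁ (refl , _)) = refl
  EarliestArrival-unique D (v ∷ w ∷ R) (inj₁ (_ , none)) (inj₂ (_ , _ , (es , path , _) , _)) =
    ⊥-elim (none es path)
  EarliestArrival-unique D (v ∷ w ∷ R) (inj₂ (_ , _ , (es , path , _) , _)) (inj₁ (_ , none)) =
    ⊥-elim (none es path)
  EarliestArrival-unique D (v ∷ w ∷ R) (inj₂ (t₁ , refl , (es₁ , path₁ , arr₁) , min₁))
                                       (inj₂ (t₂ , refl , (es₂ , path₂ , arr₂) , min₂)) =
    cong fin (≤-antisym (subst (t₁ ≤_) arr₂ (min₁ es₂ path₂)) (subst (t₂ ≤_) arr₁ (min₂ es₁ path₁)))

  earliestArrival-≤-table : ∀ v vs → Unique (v ∷ vs) → ∀ y D → ∣ D ∣ ≤ y →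
                            earliestArrival D v vs ≤∞ table G δ (v ∷ vs) y
  earliestArrival-≤-table v vs = go (reverseView vs)
    where
    go : ∀ {vs} → Reverse vs → Unique (v ∷ vs) → ∀ y D → ∣ D ∣ ≤ y →
         earliestArrival D v vs ≤∞ table G δ (v ∷ vs) y
    go []              _      y D _     = ≤∞-refl
    go (xs ∶ rv ∶ʳ w) unique y D ∣D∣≤y = begin
      earliestArrival D v (xs ∷ʳ w)
        ≡⟨ earliestFrom-∷ʳ D (fin 0) v xs w ⟩
      earliestHop D u w (earliestArrival D v xs)
        ≡⟨ cong (earliestHop D u w) (earliestFrom-local (fin 0) v xs beforeW) ⟩
      earliestHop D u w (earliestArrival Dₚ v xs)
        ≤⟨ earliestHop-≤-aFun D u w (earliestArrival Dₚ v xs) _ ≤-refl ⟩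
      aFun G δ u w (earliestArrival Dₚ v xs) ∣ D ∩ Iw ∣
        ≤⟨ aFun-mono u w (go rv uniqueₚ c Dₚ ≤-refl) ∣D∩Iw∣≤y∸c ⟩
      aFun G δ u w (A c) (y ∸ c)
        ≤⟨ maxUpTo-ub (λ y′ → aFun G δ u w (A y′) (y ∸ y′)) y c≤y ⟩
      maxUpTo G δ y (λ y′ → aFun G δ u w (A y′) (y ∸ y′))
        ≡⟨ tableFrom-∷ʳ (λ _ → fin 0) v xs w y ⟨
      table G δ (v ∷ (xs ∷ʳ w)) y
        ∎
      where
      open ≤∞-Reasoning
      u = lastOf v xs
      A = table G δ (v ∷ xs)
      Iw = arcsInto w
      Dₚ = D ─ Iw
      c = ∣ Dₚ ∣
      uniqueₚ = proj₁ (Unique-∷ʳ⁻ (v ∷ xs) unique)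
      w∉xs : w ∉ xs
      w∉xs = proj₂ (Unique-∷ʳ⁻ (v ∷ xs) unique) ∘ there
      beforeW : ∀ i → end (arcs G i) ∈ xs → lookup D i ≡ lookup Dₚ i
      beforeW i i∈ = sym (lookup-─-outside D Iw i (lookup-arcsInto-≢ (λ e≡w → w∉xs (subst (_∈ xs) e≡w i∈))))
      split : c + ∣ D ∩ Iw ∣ ≤ y
      split = ≤-trans (≤-reflexive (∣p─q∣+∣p∩q∣≡∣p∣ D Iw)) ∣D∣≤y
      c≤y : c ≤ y
      c≤y = ≤-trans (m≤m+n c _) split
      ∣D∩Iw∣≤y∸c : ∣ D ∩ Iw ∣ ≤ y ∸ c
      ∣D∩Iw∣≤y∸c = ≤-trans (≤-reflexive (sym (m+n∸m≡n c _))) (∸-monoˡ-≤ c split)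

  table-attained : ∀ v vs → Unique (v ∷ vs) → ∀ y →
                   ∃[ D ] (∣ D ∣ ≤ y × earliestArrival D v vs ≡ table G δ (v ∷ vs) y)
  table-attained v vs = go (reverseView vs)
    where
    go : ∀ {vs} → Reverse vs → Unique (v ∷ vs) → ∀ y →
         ∃[ D ] (∣ D ∣ ≤ y × earliestArrival D v vs ≡ table G δ (v ∷ vs) y)
    go [] _ y = ⊥ , subst (_≤ y) (sym (∣⊥∣≡0 m)) z≤n , refl
    go (xs ∶ rv ∶ʳ w) unique y
      with maxUpTo-attained (λ y′ → aFun G δ (lastOf v xs) w (table G δ (v ∷ xs) y′) (y ∸ y′)) y
    ... | y₀ , y₀≤y , max≡ with go rv (proj₁ (Unique-∷ʳ⁻ (v ∷ xs) unique)) y₀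
    ... | D₀ , ∣D₀∣≤y₀ , arr₀ with aFun-attained (lastOf v xs) w (table G δ (v ∷ xs) y₀) (y ∸ y₀)
    ... | Dₛ , ∣Dₛ∣≤ , onlyIntoW , hop≡ = D , size , value
      where
      u = lastOf v xs
      A = table G δ (v ∷ xs)
      Iw = arcsInto w
      D = (D₀ ─ Iw) ∪ Dₛ
      w∉xs : w ∉ xs
      w∉xs = proj₂ (Unique-∷ʳ⁻ (v ∷ xs) unique) ∘ there
      size : ∣ D ∣ ≤ y
      size = begin
        ∣ D ∣                 ≤⟨ ∣p∪q∣≤∣p∣+∣q∣ (D₀ ─ Iw) Dₛ ⟩
        ∣ D₀ ─ Iw ∣ + ∣ Dₛ ∣  ≤⟨ +-mono-≤ (≤-trans (∣p─q∣≤∣p∣ D₀ Iw) ∣D₀∣≤y₀) ∣Dₛ∣≤ ⟩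
        y₀ + (y ∸ y₀)         ≡⟨ m+[n∸m]≡n y₀≤y ⟩
        y                     ∎
        where open ≤-Reasoning
      beforeW : ∀ i → end (arcs G i) ∈ xs → lookup D i ≡ lookup D₀ i
      beforeW i i∈ = begin
        lookup D i                        ≡⟨ lookup-zipWith _∨_ i (D₀ ─ Iw) Dₛ ⟩
        lookup (D₀ ─ Iw) i ∨ lookup Dₛ i  ≡⟨ cong₂ _∨_ (lookup-─-outside D₀ Iw i (lookup-arcsInto-≢ e≢w))
                                                       (onlyIntoW i e≢w) ⟩
        lookup D₀ i ∨ false               ≡⟨ ∨-identityʳ (lookup D₀ i) ⟩
        lookup D₀ i                       ∎
        where
        open ≡-Reasoning
        e≢w : end (arcs G i) ≢ w
        e≢w e≡w = w∉xs (subst (_∈ xs) e≡w i∈)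
      intoW : ∀ i → end (arcs G i) ≡ w → lookup D i ≡ lookup Dₛ i
      intoW i e≡w = trans (lookup-zipWith _∨_ i (D₀ ─ Iw) Dₛ)
                          (cong (_∨ lookup Dₛ i) (lookup-─-inside D₀ Iw i (lookup-arcsInto-≡ e≡w)))
      A-local : earliestArrival D v xs ≡ earliestArrival D₀ v xs
      A-local = earliestFrom-local (fin 0) v xs beforeW
      value : earliestArrival D v (xs ∷ʳ w) ≡ table G δ (v ∷ (xs ∷ʳ w)) y
      value = begin
        earliestArrival D v (xs ∷ʳ w)                        ≡⟨ earliestFrom-∷ʳ D (fin 0) v xs w ⟩
        earliestHop D u w (earliestArrival D v xs)           ≡⟨ cong (earliestHop D u w) (trans A-local arr₀) ⟩
        earliestHop D u w (A y₀)                             ≡⟨ earliestHop-local {D} {Dₛ} u w (A y₀) intoW ⟩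
        earliestHop Dₛ u w (A y₀)                            ≡⟨ hop≡ ⟩
        aFun G δ u w (A y₀) (y ∸ y₀)                         ≡⟨ max≡ ⟨
        maxUpTo G δ y (λ y′ → aFun G δ u w (A y′) (y ∸ y′))  ≡⟨ tableFrom-∷ʳ (λ _ → fin 0) v xs w y ⟨
        table G δ (v ∷ (xs ∷ʳ w)) y                          ∎
        where open ≡-Reasoning

  table-worstCaseArrival : ∀ v vs → Unique (v ∷ vs) → ∀ y →
                           WorstCaseArrival G δ y (v ∷ vs) (table G δ (v ∷ vs) y)
                           × (Robust G δ y (v ∷ vs) ⇔ IsFinite (table G δ (v ∷ vs) y))
  table-worstCaseArrival v vs unique y with table-attained v vs unique y | table G δ (v ∷ vs) y in eq
  ... | D₀ , ∣D₀∣≤y , arr₀ | ∞ = inj₁ (notRobust , refl) , mk⇔ (⊥-elim ∘ notRobust) λ ()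
    where
    notRobust : ¬ Robust G δ y (v ∷ vs)
    notRobust robust with Equivalence.to (walk⇔finite D₀ v vs) (robust D₀ ∣D₀∣≤y)
    ... | t , fin≡ with trans (sym (trans arr₀ eq)) fin≡
    ...   | ()
  ... | D₀ , ∣D₀∣≤y , arr₀ | fin t =
    inj₂ (robust , upper , (D₀ , ∣D₀∣≤y , attained)) , mk⇔ (λ _ → t , refl) (λ _ → robust)
    where
    bounded : ∀ D → ∣ D ∣ ≤ y → earliestArrival D v vs ≤∞ fin t
    bounded D ∣D∣≤y = subst (earliestArrival D v vs ≤∞_) eq (earliestArrival-≤-table v vs unique y D ∣D∣≤y)
    robust : Robust G δ y (v ∷ vs)
    robust D ∣D∣≤y = Equivalence.from (walk⇔finite D v vs) (≤∞fin⇒finite (bounded D ∣D∣≤y))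
    upper : ∀ D → ∣ D ∣ ≤ y → ∀ z → EarliestArrival G δ D (v ∷ vs) z → z ≤∞ fin t
    upper D ∣D∣≤y z earliest = subst (_≤∞ fin t)
      (EarliestArrival-unique D (v ∷ vs) (earliestArrival-correct D v vs unique) earliest) (bounded D ∣D∣≤y)
    attained : EarliestArrival G δ D₀ (v ∷ vs) (fin t)
    attained =
      subst (EarliestArrival G δ D₀ (v ∷ vs)) (trans arr₀ eq) (earliestArrival-correct D₀ v vs unique)

-- Delay sets are subsets of arc indices, so injectivity of arcs G is not needed.
lemma6 : ∀ {n m : ℕ} (G : TemporalGraph n m) → Injective _≡_ _≡_ (arcs G) →
         (R : Route n) → Unique R →
         (j y δ : ℕ) → 1 ≤ j → j ≤ length R →
         WorstCaseArrival G δ y (take j R) (table G δ (take j R) y)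
         × (Robust G δ y (take j R) ⇔ IsFinite (table G δ (take j R) y))
lemma6 G _ (v ∷ R) unique (suc j) y δ _ _ = table-worstCaseArrival G δ v (take j R) (take⁺ (suc j) unique) y
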